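{- Let $i \geq 7$. The Fibonacci word $F_i$ has exactly three net occurrences, namely: the occurrence of $F_{i-2}$ starting at position $f_{i-1}+1$, and the two occurrences of $F_{i-2}\,Q_i$ starting at positions $1$ and $f_{i-2}+1$.
   Context: Strings are over the alphabet $\{\texttt{a},\texttt{b}\}$; positions are 1-indexed and $T[i\ldots j]$ denotes the substring from position $i$ to position $j$. Fibonacci words: $F_1=\texttt{b}$, $F_2=\texttt{a}$, $F_k=F_{k-1}F_{k-2}$ for $k\ge 3$; $f_k=|F_k|$. For $i\ge 7$, $Q_i := F_{i-5}F_{i-6}\cdots F_3F_2$ (concatenation in decreasing order of index). In a text $T$ of length $n$, an occurrence is a pair $(i,j)$ with $1\le i\le j\le n$; it is an occurrence of $S$ if $T[i\ldots j]=S$, and "$S$ occurs at position $i$" means $T[i\ldots i+|S|-1]=S$. A string is unique in $T$ if it occurs exactly once and repeated if it occurs at least twice. An occurrence $(i,j)$ is a net occurrence if $T[i\ldots j]$ is repeated while both $T[i-1\ldots j]$ and $T[i\ldots j+1]$ are unique; by convention $T[i-1\ldots j]$ is considered unique when $i=1$ and $T[i\ldots j+1]$ is considered unique when $j=n$. -}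

module Defs where

open import Data.Nat using (ℕ; zero; suc; _+_; _∸_; _≤_)
open import Data.List using (List; []; _∷_; _++_; length; take; drop)
open import Data.Product using (Σ; _×_; _,_)
open import Data.Sum using (_⊎_)
open import Relation.Binary.PropositionalEquality using (_≡_; _≢_)

data Letter : Set where
  a b : Letter

Word : Set
Word = List Letter

-- Fibonacci words, 1-indexed: F 1 = b, F 2 = a, F (k) = F (k-1) F (k-2).
-- F 0 is unused (set to the empty word).
F : ℕ → Word
F zero = []
F (suc zero) = b ∷ []
F (suc (suc zero)) = a ∷ []
F (suc (suc (suc k))) = F (suc (suc k)) ++ F (suc k)

f : ℕ → ℕ
f k = length (F k)

Qdown : ℕ → Word
Qdown zero = []
Qdown (suc zero) = []
Qdown (suc (suc k)) = F (suc (suc k)) ++ Qdown (suc k)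

-- Q i = F (i-5) F (i-6) ... F 3 F 2   (meaningful for i ≥ 7)
Q : ℕ → Word
Q i = Qdown (i ∸ 5)

-- T[i..j] (1-indexed, inclusive); meaningful when 1 ≤ i ≤ j ≤ |T|
sub : Word → ℕ → ℕ → Word
sub T i j = take (suc (j ∸ i)) (drop (i ∸ 1) T)

OccursAt : Word → Word → ℕ → Set
OccursAt T S p = (1 ≤ p) × (take (length S) (drop (p ∸ 1) T) ≡ S)

Unique : Word → Word → Set
Unique T S = Σ ℕ (λ p → OccursAt T S p × (∀ q → OccursAt T S q → q ≡ p))

Repeated : Word → Word → Set
Repeated T S = Σ ℕ (λ p → Σ ℕ (λ q → (p ≢ q) × OccursAt T S p × OccursAt T S q))

NetOcc : Word → ℕ → ℕ → Set
NetOcc T i j =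
  (1 ≤ i) × (i ≤ j) × (j ≤ length T)
  × Repeated T (sub T i j)
  × ((i ≡ 1) ⊎ Unique T (sub T (i ∸ 1) j))
  × ((j ≡ length T) ⊎ Unique T (sub T i (suc j)))

{-# OPTIONS --safe #-}
-- The Fibonacci morphism φ (a ↦ ab, b ↦ a) maps F (k + 1) to F (k + 2), and it can be undone on
-- occurrences: an occurrence in φ T of (flip x) (φ c) a (flip x) comes from an occurrence of x c x
-- in T.  As F (3 + n) is Qdown (1 + n) followed by two distinct letters, the words
-- w n = x Qdown (1 + n) x, with x = X n alternating between a and b, hence occur at most once in
-- F (5 + n) and in F (6 + n), by induction from the single occurrence of aa in F 5 and in F 6.
--
-- Let T = F (7 + m) = F (6 + m) F (5 + m) and P = F (5 + m) Q (7 + m), so that T = P x y F (5 + m)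
-- = F (5 + m) P x′ y′.  A factor of T inside one of these two occurrences of P, or inside the suffix
-- F (5 + m), is repeated; a factor covering the occurrence of w (1 + m) or of w (2 + m) is unique; and
-- every factor is in one of these cases.  Being a net occurrence thus becomes an arithmetic condition
-- on the endpoints, whose only solutions are the three occurrences of the theorem.

module Submission where

open import Defs
open import Data.Nat using (ℕ; zero; suc; _+_; _∸_; _≤_; _<_; z≤n; s≤s; s≤s⁻¹)
open import Data.Nat.Properties
open import Data.List using (List; []; _∷_; _++_; length; take; drop)
open import Data.List.Properties
  using (++-assoc; ++-identityʳ; ++-cancelʳ; length-++; length-take; length-drop; take++drop≡id;
         ∷-injectiveˡ; ∷-injectiveʳ)
open import Data.Product using (_×_; _,_; proj₁; proj₂; ∃; ∃₂)
open import Data.Sum using (_⊎_; inj₁; inj₂; [_,_]′)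
open import Data.Sum.Function.Propositional using (_⊎-⇔_)
open import Data.Empty using (⊥-elim)
open import Function using (id; _∘_)
open import Function.Bundles using (_⇔_; mk⇔; Equivalence)
open import Function.Construct.Composition using (_⇔-∘_)
open import Function.Construct.Symmetry using (⇔-sym)
open import Function.Construct.Identity using (⇔-id)
open import Relation.Nullary using (¬_; yes; no)
open import Relation.Binary.PropositionalEquality

-- Occurrences of factors

private
  variable
    E : Set

drop-length-++ : ∀ (u : List E) {R} → drop (length u) (u ++ R) ≡ R
drop-length-++ [] = refl
drop-length-++ (_ ∷ u) = drop-length-++ u

take-length-++ : ∀ (S : List E) {v} → take (length S) (S ++ v) ≡ S
take-length-++ [] = refl
take-length-++ (x ∷ S) = cong (x ∷_) (take-length-++ S)

length-take-≤ : ∀ {n} (xs : List E) → n ≤ length xs → length (take n xs) ≡ n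
length-take-≤ {n = n} xs n≤ = trans (length-take n xs) (m≤n⇒m⊓n≡m n≤)

length-∷ʳ : ∀ (u : List E) x → length (u ++ x ∷ []) ≡ suc (length u)
length-∷ʳ u x = trans (length-++ u) (+-comm (length u) 1)

++-∷ʳ-∷ʳ : ∀ (u : List E) x y v → ((u ++ x ∷ []) ++ y ∷ []) ++ v ≡ u ++ x ∷ y ∷ v
++-∷ʳ-∷ʳ u x y v = trans (++-assoc (u ++ x ∷ []) (y ∷ []) v) (++-assoc u (x ∷ []) (y ∷ v))

++-split : ∀ (L₁ : List E) {R₁ L₂ R₂} → L₁ ++ R₁ ≡ L₂ ++ R₂ → length L₁ ≤ length L₂ →
  ∃ λ (α : List E) → L₂ ≡ L₁ ++ α × R₁ ≡ α ++ R₂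
++-split [] {L₂ = L₂} eq _ = L₂ , refl , eq
++-split (_ ∷ _) {L₂ = []} _ ()
++-split (x ∷ L₁) {L₂ = y ∷ L₂} eq (s≤s L₁≤L₂) with ++-split L₁ (∷-injectiveʳ eq) L₁≤L₂
... | α , e₁ , e₂ = α , cong₂ _∷_ (sym (∷-injectiveˡ eq)) e₁ , e₂

n∸1<n : ∀ {n} → 0 < n → n ∸ 1 < n
n∸1<n {suc n} _ = n<1+n n

-- The occurrence T[start + 1 .. end], in the 1-indexed notation of Defs.
record Occurrence (T S : Word) : Set where
  constructor occurrence
  field
    before after : Word
    split : T ≡ before ++ S ++ after

  start end : ℕ
  start = length before
  end = start + length S

open Occurrence

AtMostOnce : Word → Word → Set
AtMostOnce T S = (o o′ : Occurrence T S) → before o ≡ before o′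

at-most-once-at : ∀ {T S} U → ((o : Occurrence T S) → before o ≡ U) → AtMostOnce T S
at-most-once-at U at o o′ = trans (at o) (sym (at o′))

occursAt : ∀ {T S} (o : Occurrence T S) → OccursAt T S (suc (start o))
occursAt {S = S} (occurrence U _ refl) = s≤s z≤n , trans (cong (take (length S)) (drop-length-++ U)) (take-length-++ S)

occurrence-at : ∀ {S} k T → 0 < length S → take (length S) (drop k T) ≡ S →
  ∃ λ (o : Occurrence T S) → start o ≡ k
occurrence-at {S} zero T _ eq = occurrence [] (drop (length S) T) T≡ , refl
  where
  T≡ : T ≡ [] ++ S ++ drop (length S) T
  T≡ = trans (sym (take++drop≡id (length S) T)) (cong (_++ drop (length S) T) eq)
occurrence-at {[]} (suc k) [] () _
occurrence-at {_ ∷ _} (suc k) [] _ ()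
occurrence-at (suc k) (x ∷ T) 0<|S| eq with occurrence-at k T 0<|S| eq
... | occurrence U V e , refl = occurrence (x ∷ U) V (cong (x ∷_) e) , refl

unique : ∀ {T S} (o : Occurrence T S) → 0 < length S → AtMostOnce T S → Unique T S
unique {T} {S} o 0<|S| once = suc (start o) , occursAt o , only
  where
  only : ∀ p → OccursAt T S p → p ≡ suc (start o)
  only zero (() , _)
  only (suc k) (_ , occ) with occurrence-at k T 0<|S| occ
  ... | o′ , refl = cong (suc ∘ length) (once o′ o)

repeated : ∀ {T S} (o o′ : Occurrence T S) → start o ≢ start o′ → Repeated T S
repeated o o′ o≢o′ = suc (start o) , suc (start o′) , o≢o′ ∘ suc-injective , occursAt o , occursAt o′

unique⇒¬repeated : ∀ {T S} → Unique T S → ¬ Repeated T S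
unique⇒¬repeated (_ , _ , only) (p , q , p≢q , occ-p , occ-q) = p≢q (trans (only p occ-p) (sym (only q occ-q)))

inner : ∀ {T} α {W} β → Occurrence T (α ++ W ++ β) → Occurrence T W
inner α {W} β (occurrence U V e) = occurrence (U ++ α) (β ++ V) (trans e regroup)
  where
  open ≡-Reasoning
  regroup : U ++ (α ++ W ++ β) ++ V ≡ (U ++ α) ++ W ++ β ++ V
  regroup = begin
    U ++ (α ++ W ++ β) ++ V  ≡⟨ cong (U ++_) (++-assoc α (W ++ β) V) ⟩
    U ++ α ++ (W ++ β) ++ V  ≡⟨ cong (λ z → U ++ α ++ z) (++-assoc W β V) ⟩
    U ++ α ++ W ++ β ++ V    ≡⟨ ++-assoc U α _ ⟨
    (U ++ α) ++ W ++ β ++ V  ∎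

nested : ∀ {T M W} (o : Occurrence T M) (o₀ : Occurrence T W) → start o ≤ start o₀ → end o₀ ≤ end o →
  ∃₂ λ (α β : Word) → M ≡ α ++ W ++ β × before o₀ ≡ before o ++ α
nested {M = M} {W} (occurrence U V e) (occurrence U₀ V₀ e₀) U≤U₀ end≤
  with ++-split U {M ++ V} {U₀} (trans (sym e) e₀) U≤U₀
... | α , refl , M++V≡ with ++-split (α ++ W) {V₀} {M} (trans (++-assoc α W V₀) (sym M++V≡)) αW≤M
  where
  open ≤-Reasoning
  αW≤M : length (α ++ W) ≤ length M
  αW≤M = +-cancelˡ-≤ (length U) _ _ (begin
    length U + length (α ++ W)        ≡⟨ cong (length U +_) (length-++ α) ⟩
    length U + (length α + length W)  ≡⟨ +-assoc (length U) _ _ ⟨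
    length U + length α + length W    ≡⟨ cong (_+ length W) (length-++ U) ⟨
    length (U ++ α) + length W        ≤⟨ end≤ ⟩
    length U + length M               ∎)
...   | β , M≡ , _ = α , β , trans M≡ (++-assoc α W β) , refl

at-most-once-cover : ∀ {T M W} (o : Occurrence T M) (o₀ : Occurrence T W) → start o ≤ start o₀ → end o₀ ≤ end o →
  AtMostOnce T W → AtMostOnce T M
at-most-once-cover o o₀ o≤o₀ o₀≤o once with nested o o₀ o≤o₀ o₀≤o
... | α , β , refl , o₀≡ =
  at-most-once-at (before o) λ o′ → ++-cancelʳ α _ _ (trans (once (inner α β o′) o₀) o₀≡)

repeated-inside : ∀ {T M S} (o : Occurrence T M) (o₁ o₂ : Occurrence T S) → start o₁ ≢ start o₂ →
  start o₁ ≤ start o → end o ≤ end o₁ → Repeated T M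
repeated-inside o o₁ o₂ o₁≢o₂ o₁≤o o≤o₁ with nested o₁ o o₁≤o o≤o₁
... | α , β , refl , _ = repeated (inner α β o₁) (inner α β o₂) (o₁≢o₂ ∘ cancel)
  where
  cancel : length (before o₁ ++ α) ≡ length (before o₂ ++ α) → start o₁ ≡ start o₂
  cancel eq = +-cancelʳ-≡ (length α) _ _ (trans (sym (length-++ (before o₁))) (trans eq (length-++ (before o₂))))

sub-occurrence : ∀ T {x y} → x < y → y ≤ length T →
  ∃ λ (o : Occurrence T (sub T (suc x) y)) → start o ≡ x × end o ≡ y × 0 < length (sub T (suc x) y)
sub-occurrence T {x} {y} x<y y≤|T| =
  occurrence (take x T) (drop k (drop x T)) T≡ , |U|≡x , trans (cong₂ _+_ |U|≡x |M|≡k) x+k≡y ,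
  subst (0 <_) (sym |M|≡k) (s≤s z≤n)
  where
  k = suc (y ∸ suc x)
  x+k≡y : x + k ≡ y
  x+k≡y = trans (+-suc x (y ∸ suc x)) (m+[n∸m]≡n x<y)
  T≡ : T ≡ take x T ++ take k (drop x T) ++ drop k (drop x T)
  T≡ = sym (trans (cong (take x T ++_) (take++drop≡id k (drop x T))) (take++drop≡id x T))
  |U|≡x : length (take x T) ≡ x
  |U|≡x = length-take-≤ T (≤-trans (m≤m+n x k) (≤-trans (≤-reflexive x+k≡y) y≤|T|))
  |M|≡k : length (take k (drop x T)) ≡ k
  |M|≡k = length-take-≤ (drop x T) (subst (k ≤_) (sym (length-drop x T))
            (m+n≤o⇒m≤o∸n k (≤-trans (≤-reflexive (trans (+-comm k x) x+k≡y)) y≤|T|)))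

sub-of-occurrence : ∀ {T S} (o : Occurrence T S) → 0 < length S → sub T (suc (start o)) (end o) ≡ S
sub-of-occurrence {S = []} _ ()
sub-of-occurrence {S = s ∷ S} (occurrence U V refl) _ = begin
  take (suc (length U + suc (length S) ∸ suc (length U))) (drop (length U) (U ++ (s ∷ S) ++ V))
    ≡⟨ cong₂ take (cong suc window-length) (drop-length-++ U) ⟩
  take (length (s ∷ S)) ((s ∷ S) ++ V)  ≡⟨ take-length-++ (s ∷ S) ⟩
  s ∷ S                                 ∎
  where
  open ≡-Reasoning
  window-length : length U + suc (length S) ∸ suc (length U) ≡ length S
  window-length = trans (cong (_∸ suc (length U)) (+-suc (length U) (length S))) (m+n∸m≡n (length U) (length S))

occurrence⇔ : ∀ {T S p q e} (o : Occurrence T S) → 0 < length S → end o ≡ e →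
  ((p ≡ start o + 1) × (q ≡ p + length S ∸ 1) × (sub T p q ≡ S)) ⇔ ((p ≡ suc (start o)) × (q ≡ e))
occurrence⇔ {T} {S} {p} {q} o 0<|S| refl = mk⇔ to from
  where
  to : (p ≡ start o + 1) × (q ≡ p + length S ∸ 1) × (sub T p q ≡ S) → (p ≡ suc (start o)) × (q ≡ end o)
  to (refl , refl , _) = +-comm (start o) 1 , cong (λ p → p + length S ∸ 1) (+-comm (start o) 1)
  from : (p ≡ suc (start o)) × (q ≡ end o) → (p ≡ start o + 1) × (q ≡ p + length S ∸ 1) × (sub T p q ≡ S)
  from (refl , refl) = +-comm 1 (start o) , refl , sub-of-occurrence o 0<|S|

-- The Fibonacci morphism

flip : Letter → Letter
flip a = b
flip b = a

flip-involutive : ∀ x → flip (flip x) ≡ x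
flip-involutive a = refl
flip-involutive b = refl

φ : Word → Word
φ [] = []
φ (a ∷ u) = a ∷ b ∷ φ u
φ (b ∷ u) = a ∷ φ u

φ-++ : ∀ u v → φ (u ++ v) ≡ φ u ++ φ v
φ-++ [] v = refl
φ-++ (a ∷ u) v = cong (λ z → a ∷ b ∷ z) (φ-++ u v)
φ-++ (b ∷ u) v = cong (a ∷_) (φ-++ u v)

φ-F : ∀ k → φ (F (suc k)) ≡ F (2 + k)
φ-F zero = refl
φ-F (suc zero) = refl
φ-F (suc (suc k)) = trans (φ-++ (F (2 + k)) (F (suc k))) (cong₂ _++_ (φ-F (suc k)) (φ-F k))

φ-≢-b∷ : ∀ T {R} → φ T ≢ b ∷ R
φ-≢-b∷ [] ()
φ-≢-b∷ (a ∷ T) ()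
φ-≢-b∷ (b ∷ T) ()

φ-++-a∷-≢-b∷ : ∀ W {R S} → φ W ++ a ∷ R ≢ b ∷ S
φ-++-a∷-≢-b∷ [] ()
φ-++-a∷-≢-b∷ (a ∷ W) ()
φ-++-a∷-≢-b∷ (b ∷ W) ()

φ-≡-a∷b∷ : ∀ T {R} → φ T ≡ a ∷ b ∷ R → ∃ λ (T′ : Word) → T ≡ a ∷ T′
φ-≡-a∷b∷ [] ()
φ-≡-a∷b∷ (a ∷ T) _ = T , refl
φ-≡-a∷b∷ (b ∷ T) eq = ⊥-elim (φ-≢-b∷ T (∷-injectiveʳ eq))

φ-split-a : ∀ T u {R} → φ T ≡ u ++ a ∷ R →
  ∃₂ λ (T₁ T₂ : Word) → T ≡ T₁ ++ T₂ × φ T₁ ≡ u × φ T₂ ≡ a ∷ R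
φ-split-a T [] eq = [] , T , refl , refl , eq
φ-split-a [] (_ ∷ _) ()
φ-split-a (a ∷ T) (_ ∷ []) ()
φ-split-a (a ∷ T) (a ∷ b ∷ u) eq with φ-split-a T u (∷-injectiveʳ (∷-injectiveʳ eq))
... | T₁ , T₂ , e , e₁ , e₂ = a ∷ T₁ , T₂ , cong (a ∷_) e , cong (λ z → a ∷ b ∷ z) e₁ , e₂
φ-split-a (a ∷ T) (a ∷ a ∷ _) ()
φ-split-a (a ∷ T) (b ∷ _) ()
φ-split-a (b ∷ T) (a ∷ u) eq with φ-split-a T u (∷-injectiveʳ eq)
... | T₁ , T₂ , e , e₁ , e₂ = b ∷ T₁ , T₂ , cong (b ∷_) e , cong (a ∷_) e₁ , e₂
φ-split-a (b ∷ T) (b ∷ _) ()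

φ-split-b : ∀ T u {R} → φ T ≡ u ++ b ∷ R →
  ∃₂ λ (T₁ T₂ : Word) → T ≡ T₁ ++ a ∷ T₂ × u ≡ φ T₁ ++ a ∷ [] × φ T₂ ≡ R
φ-split-b [] [] ()
φ-split-b [] (_ ∷ _) ()
φ-split-b (a ∷ T) [] ()
φ-split-b (a ∷ T) (a ∷ []) refl = [] , T , refl , refl , refl
φ-split-b (a ∷ T) (a ∷ b ∷ u) eq with φ-split-b T u (∷-injectiveʳ (∷-injectiveʳ eq))
... | T₁ , T₂ , e , e₁ , e₂ = a ∷ T₁ , T₂ , cong (a ∷_) e , cong (λ z → a ∷ b ∷ z) e₁ , e₂
φ-split-b (a ∷ T) (a ∷ a ∷ _) ()
φ-split-b (a ∷ T) (b ∷ _) ()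
φ-split-b (b ∷ T) [] ()
φ-split-b (b ∷ T) (a ∷ u) eq with φ-split-b T u (∷-injectiveʳ eq)
... | T₁ , T₂ , e , e₁ , e₂ = b ∷ T₁ , T₂ , cong (b ∷_) e , cong (a ∷_) e₁ , e₂
φ-split-b (b ∷ T) (b ∷ _) ()

φ-cancelˡ : ∀ W T {R} → φ T ≡ φ W ++ a ∷ R → ∃ λ (T′ : Word) → T ≡ W ++ T′ × φ T′ ≡ a ∷ R
φ-cancelˡ [] T eq = T , refl , eq
φ-cancelˡ (a ∷ W) [] ()
φ-cancelˡ (a ∷ W) (a ∷ T) eq with φ-cancelˡ W T (∷-injectiveʳ (∷-injectiveʳ eq))
... | T′ , e , e′ = T′ , cong (a ∷_) e , e′
φ-cancelˡ (a ∷ W) (b ∷ T) eq = ⊥-elim (φ-≢-b∷ T (∷-injectiveʳ eq))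
φ-cancelˡ (b ∷ W) [] ()
φ-cancelˡ (b ∷ W) (a ∷ T) eq = ⊥-elim (φ-++-a∷-≢-b∷ W (sym (∷-injectiveʳ eq)))
φ-cancelˡ (b ∷ W) (b ∷ T) eq with φ-cancelˡ W T (∷-injectiveʳ eq)
... | T′ , e , e′ = T′ , cong (b ∷_) e , e′

bracket : Letter → Word → Word
bracket x c = x ∷ c ++ x ∷ []

desubst-a : ∀ c {T} (o : Occurrence (φ T) (bracket b (φ c ++ a ∷ []))) →
  ∃ λ (o′ : Occurrence T (bracket a c)) → before o ≡ φ (before o′) ++ a ∷ []
desubst-a c {T} (occurrence u v eq) with φ-split-b T u eq
... | T₁ , T₂ , refl , u≡ , e₂ with φ-cancelˡ c T₂ (trans e₂ (++-∷ʳ-∷ʳ (φ c) a b v))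
...   | T′ , refl , e′ with φ-≡-a∷b∷ T′ e′
...     | T₃ , refl = occurrence T₁ T₃ (cong (λ z → T₁ ++ a ∷ z) (sym (++-assoc c (a ∷ []) T₃))) , u≡

desubst-b : ∀ c {T} (o : Occurrence (φ T) (bracket a (φ c ++ a ∷ []))) →
  ∃ λ (o′ : Occurrence T (bracket b c)) → before o ≡ φ (before o′)
desubst-b c {T} (occurrence u v eq) with φ-split-a T u eq
... | T₁ , T₂ , refl , refl , e₂ with φ-cancelˡ (bracket b c) T₂ (trans e₂ (cong (a ∷_) regroup))
  where
  φcb : φ (c ++ b ∷ []) ++ a ∷ v ≡ φ c ++ a ∷ a ∷ v
  φcb = trans (cong (_++ a ∷ v) (φ-++ c (b ∷ []))) (++-assoc (φ c) (a ∷ []) (a ∷ v))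
  regroup : ((φ c ++ a ∷ []) ++ a ∷ []) ++ v ≡ φ (c ++ b ∷ []) ++ a ∷ v
  regroup = trans (++-∷ʳ-∷ʳ (φ c) a a v) (sym φcb)
...   | T₃ , refl , _ = occurrence T₁ T₃ refl , refl

φ-at-most-once : ∀ x c {T} → AtMostOnce T (bracket x c) → AtMostOnce (φ T) (bracket (flip x) (φ c ++ a ∷ []))
φ-at-most-once a c once o o′ with desubst-a c o | desubst-a c o′
... | d , e | d′ , e′ = trans e (trans (cong (λ z → φ z ++ a ∷ []) (once d d′)) (sym e′))
φ-at-most-once b c once o o′ with desubst-b c o | desubst-b c o′
... | d , e | d′ , e′ = trans e (trans (cong φ (once d d′)) (sym e′))

-- Fibonacci words

Qdown-φ : ∀ n → Qdown (2 + n) ≡ φ (Qdown (1 + n)) ++ a ∷ []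
Qdown-φ zero = refl
Qdown-φ (suc n) = begin
  F (3 + n) ++ Qdown (2 + n)                      ≡⟨ cong₂ _++_ (sym (φ-F (1 + n))) (Qdown-φ n) ⟩
  φ (F (2 + n)) ++ φ (Qdown (1 + n)) ++ a ∷ []    ≡⟨ ++-assoc (φ (F (2 + n))) _ _ ⟨
  (φ (F (2 + n)) ++ φ (Qdown (1 + n))) ++ a ∷ []  ≡⟨ cong (_++ a ∷ []) (φ-++ (F (2 + n)) (Qdown (1 + n))) ⟨
  φ (Qdown (2 + n)) ++ a ∷ []                     ∎
  where open ≡-Reasoning

X : ℕ → Letter
X zero = a
X (suc n) = flip (X n)

φ-pair : ∀ x → φ (x ∷ flip x ∷ []) ≡ a ∷ flip x ∷ flip (flip x) ∷ []
φ-pair a = refl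
φ-pair b = refl

F-ends : ∀ n → F (3 + n) ≡ (Qdown (1 + n) ++ X n ∷ []) ++ flip (X n) ∷ []
F-ends zero = refl
F-ends (suc n) = begin
  F (4 + n)                                               ≡⟨ φ-F (2 + n) ⟨
  φ (F (3 + n))                                           ≡⟨ cong φ (F-ends n) ⟩
  φ ((Qdown (1 + n) ++ X n ∷ []) ++ flip (X n) ∷ [])      ≡⟨ cong φ (++-assoc (Qdown (1 + n)) _ _) ⟩
  φ (Qdown (1 + n) ++ X n ∷ flip (X n) ∷ [])              ≡⟨ φ-++ (Qdown (1 + n)) _ ⟩
  φ (Qdown (1 + n)) ++ φ (X n ∷ flip (X n) ∷ [])          ≡⟨ cong (φ (Qdown (1 + n)) ++_) (φ-pair (X n)) ⟩
  φ (Qdown (1 + n)) ++ a ∷ X (1 + n) ∷ flip (X (1 + n)) ∷ []  ≡⟨ ++-∷ʳ-∷ʳ (φ (Qdown (1 + n))) a _ _ ⟨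
  ((φ (Qdown (1 + n)) ++ a ∷ []) ++ X (1 + n) ∷ []) ++ flip (X (1 + n)) ∷ []
      ≡⟨ cong (λ z → (z ++ X (1 + n) ∷ []) ++ flip (X (1 + n)) ∷ []) (Qdown-φ n) ⟨
  (Qdown (2 + n) ++ X (1 + n) ∷ []) ++ flip (X (1 + n)) ∷ []  ∎
  where open ≡-Reasoning

f-ends : ∀ n → f (3 + n) ≡ suc (length (Qdown (1 + n) ++ X n ∷ []))
f-ends n = trans (cong length (F-ends n)) (length-∷ʳ (Qdown (1 + n) ++ X n ∷ []) (flip (X n)))

w : ℕ → Word
w n = bracket (X n) (Qdown (1 + n))

F-around-w : ∀ n → F (5 + n) ≡ (Qdown (2 + n) ++ X (1 + n) ∷ []) ++ w n ++ X (1 + n) ∷ []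
F-around-w n = begin
  F (4 + n) ++ F (3 + n)                                         ≡⟨ cong₂ _++_ (F-ends (1 + n)) (F-ends n) ⟩
  (U ++ flip (X (1 + n)) ∷ []) ++ (Qdown (1 + n) ++ X n ∷ []) ++ X (1 + n) ∷ []
      ≡⟨ cong (λ z → (U ++ z ∷ []) ++ (Qdown (1 + n) ++ X n ∷ []) ++ X (1 + n) ∷ []) (flip-involutive (X n)) ⟩
  (U ++ X n ∷ []) ++ (Qdown (1 + n) ++ X n ∷ []) ++ X (1 + n) ∷ []  ≡⟨ ++-assoc U (X n ∷ []) _ ⟩
  U ++ w n ++ X (1 + n) ∷ []                                     ∎
  where
  open ≡-Reasoning
  U = Qdown (2 + n) ++ X (1 + n) ∷ []

f-around-w : ∀ n → f (5 + n) ≡ suc (length (Qdown (2 + n) ++ X (1 + n) ∷ []) + length (w n))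
f-around-w n = begin
  f (5 + n)                              ≡⟨ cong length (F-around-w n) ⟩
  length (U ++ w n ++ X (1 + n) ∷ [])    ≡⟨ length-++ U ⟩
  length U + length (w n ++ X (1 + n) ∷ [])  ≡⟨ cong (length U +_) (length-∷ʳ (w n) _) ⟩
  length U + suc (length (w n))          ≡⟨ +-suc (length U) _ ⟩
  suc (length U + length (w n))          ∎
  where
  open ≡-Reasoning
  U = Qdown (2 + n) ++ X (1 + n) ∷ []

w-at-most-once-step : ∀ n {k} → AtMostOnce (F (suc k)) (w n) → AtMostOnce (F (2 + k)) (w (1 + n))
w-at-most-once-step n {k} once =
  subst₂ AtMostOnce (φ-F k) (cong (bracket (X (1 + n))) (sym (Qdown-φ n)))
    (φ-at-most-once (X n) (Qdown (1 + n)) once)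

aa-in-F5 : (o : Occurrence (F 5) (a ∷ a ∷ [])) → before o ≡ a ∷ b ∷ []
aa-in-F5 (occurrence [] _ ())
aa-in-F5 (occurrence (_ ∷ []) _ ())
aa-in-F5 (occurrence (_ ∷ _ ∷ []) _ refl) = refl
aa-in-F5 (occurrence (_ ∷ _ ∷ _ ∷ []) _ ())
aa-in-F5 (occurrence (_ ∷ _ ∷ _ ∷ _ ∷ []) _ ())
aa-in-F5 (occurrence (_ ∷ _ ∷ _ ∷ _ ∷ _ ∷ []) _ ())
aa-in-F5 (occurrence (_ ∷ _ ∷ _ ∷ _ ∷ _ ∷ _ ∷ _) _ ())

aa-in-F6 : (o : Occurrence (F 6) (a ∷ a ∷ [])) → before o ≡ a ∷ b ∷ []
aa-in-F6 (occurrence [] _ ())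
aa-in-F6 (occurrence (_ ∷ []) _ ())
aa-in-F6 (occurrence (_ ∷ _ ∷ []) _ refl) = refl
aa-in-F6 (occurrence (_ ∷ _ ∷ _ ∷ []) _ ())
aa-in-F6 (occurrence (_ ∷ _ ∷ _ ∷ _ ∷ []) _ ())
aa-in-F6 (occurrence (_ ∷ _ ∷ _ ∷ _ ∷ _ ∷ []) _ ())
aa-in-F6 (occurrence (_ ∷ _ ∷ _ ∷ _ ∷ _ ∷ _ ∷ []) _ ())
aa-in-F6 (occurrence (_ ∷ _ ∷ _ ∷ _ ∷ _ ∷ _ ∷ _ ∷ []) _ ())
aa-in-F6 (occurrence (_ ∷ _ ∷ _ ∷ _ ∷ _ ∷ _ ∷ _ ∷ _ ∷ []) _ ())
aa-in-F6 (occurrence (_ ∷ _ ∷ _ ∷ _ ∷ _ ∷ _ ∷ _ ∷ _ ∷ _ ∷ _) _ ())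

w-at-most-once-F5 : ∀ n → AtMostOnce (F (5 + n)) (w n)
w-at-most-once-F5 zero = at-most-once-at _ aa-in-F5
w-at-most-once-F5 (suc n) = w-at-most-once-step n {4 + n} (w-at-most-once-F5 n)

w-at-most-once-F6 : ∀ n → AtMostOnce (F (6 + n)) (w n)
w-at-most-once-F6 zero = at-most-once-at _ aa-in-F6
w-at-most-once-F6 (suc n) = w-at-most-once-step n {5 + n} (w-at-most-once-F6 n)

-- Factors of F (7 + m)

-- Arithmetic on windows (x , y), standing for T[x + 1 .. y].  In Layout, A, B and N are the lengths
-- of F (5 + m), F (6 + m) and T = F (7 + m), and ℓ that of P.  The unique windows are those covering
-- w (1 + m) = T[A .. ℓ + 1] or w (2 + m) = T[B .. A + ℓ + 1]; the repeated ones lie inside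
-- P = T[1 .. ℓ], inside P = T[A + 1 .. A + ℓ] or inside F (5 + m) = T[B + 1 .. N].
module Windows (A B ℓ N : ℕ) (0<A : 0 < A) (0<ℓ : 0 < ℓ) (A<B : A < B) (B<N : B < N) (A+ℓ<N : A + ℓ < N)
  where

  UniqueWindow : ℕ → ℕ → Set
  UniqueWindow x y = (x < A × ℓ < y) ⊎ (x < B × A + ℓ < y)

  RepeatedWindow : ℕ → ℕ → Set
  RepeatedWindow x y = y ≤ ℓ ⊎ (A ≤ x × y ≤ A + ℓ) ⊎ B ≤ x

  classify : ∀ x y → UniqueWindow x y ⊎ RepeatedWindow x y
  classify x y with y ≤? ℓ | x <? A | y ≤? A + ℓ | x <? B
  ... | yes y≤ℓ | _       | _         | _       = inj₂ (inj₁ y≤ℓ)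
  ... | no y≰ℓ  | yes x<A | _         | _       = inj₁ (inj₁ (x<A , ≰⇒> y≰ℓ))
  ... | no _    | no x≮A  | yes y≤A+ℓ | _       = inj₂ (inj₂ (inj₁ (≮⇒≥ x≮A , y≤A+ℓ)))
  ... | no _    | no _    | no y≰A+ℓ  | yes x<B = inj₁ (inj₂ (x<B , ≰⇒> y≰A+ℓ))
  ... | no _    | no _    | no _      | no x≮B  = inj₂ (inj₂ (inj₂ (≮⇒≥ x≮B)))

  NetWindow : ℕ → ℕ → Set
  NetWindow p q = 1 ≤ p × p ≤ q × q ≤ N × RepeatedWindow (p ∸ 1) q
    × (p ≡ 1 ⊎ UniqueWindow (p ∸ 2) q) × (q ≡ N ⊎ UniqueWindow (p ∸ 1) (suc q))

  NetPosition : ℕ → ℕ → Set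
  NetPosition p q = (p ≡ suc B × q ≡ N) ⊎ (p ≡ 1 × q ≡ ℓ) ⊎ (p ≡ suc A × q ≡ A + ℓ)

  ℓ<A+ℓ : ℓ < A + ℓ
  ℓ<A+ℓ = m<n+m ℓ 0<A

  net-at-start : ∀ {q} → RepeatedWindow 0 q → (q ≡ N ⊎ UniqueWindow 0 (suc q)) → q ≡ ℓ
  net-at-start (inj₁ q≤ℓ) (inj₁ refl) = ⊥-elim (<⇒≱ (<-trans ℓ<A+ℓ A+ℓ<N) q≤ℓ)
  net-at-start (inj₁ q≤ℓ) (inj₂ (inj₁ (_ , ℓ<1+q))) = ≤-antisym q≤ℓ (s≤s⁻¹ ℓ<1+q)
  net-at-start (inj₁ q≤ℓ) (inj₂ (inj₂ (_ , A+ℓ<1+q))) =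
    ⊥-elim (<⇒≱ ℓ<A+ℓ (≤-trans (s≤s⁻¹ A+ℓ<1+q) q≤ℓ))
  net-at-start (inj₂ (inj₁ (A≤0 , _))) _ = ⊥-elim (<⇒≱ 0<A A≤0)
  net-at-start (inj₂ (inj₂ B≤0)) _ = ⊥-elim (<⇒≱ (<-trans 0<A A<B) B≤0)

  net-inside : ∀ {x q} → RepeatedWindow (suc x) q → UniqueWindow x q → (q ≡ N ⊎ UniqueWindow (suc x) (suc q)) →
    (suc x ≡ B × q ≡ N) ⊎ (suc x ≡ A × q ≡ A + ℓ)
  net-inside (inj₁ q≤ℓ) (inj₁ (_ , ℓ<q)) _ = ⊥-elim (<⇒≱ ℓ<q q≤ℓ)
  net-inside (inj₁ q≤ℓ) (inj₂ (_ , A+ℓ<q)) _ = ⊥-elim (<⇒≱ A+ℓ<q (≤-trans q≤ℓ (<⇒≤ ℓ<A+ℓ)))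
  net-inside (inj₂ (inj₁ (_ , q≤A+ℓ))) (inj₂ (_ , A+ℓ<q)) _ = ⊥-elim (<⇒≱ A+ℓ<q q≤A+ℓ)
  net-inside {x} {q} (inj₂ (inj₁ (A≤1+x , q≤A+ℓ))) (inj₁ (x<A , _)) right =
    inj₂ (≤-antisym x<A A≤1+x , at-end right)
    where
    at-end : q ≡ N ⊎ UniqueWindow (suc x) (suc q) → q ≡ A + ℓ
    at-end (inj₁ refl) = ⊥-elim (<⇒≱ A+ℓ<N q≤A+ℓ)
    at-end (inj₂ (inj₁ (1+x<A , _))) = ⊥-elim (<⇒≱ 1+x<A A≤1+x)
    at-end (inj₂ (inj₂ (_ , A+ℓ<1+q))) = ≤-antisym q≤A+ℓ (s≤s⁻¹ A+ℓ<1+q)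
  net-inside (inj₂ (inj₂ B≤1+x)) (inj₁ (x<A , _)) _ = ⊥-elim (<⇒≱ (≤-<-trans x<A A<B) B≤1+x)
  net-inside {x} {q} (inj₂ (inj₂ B≤1+x)) (inj₂ (x<B , _)) right =
    inj₁ (≤-antisym x<B B≤1+x , at-end right)
    where
    at-end : q ≡ N ⊎ UniqueWindow (suc x) (suc q) → q ≡ N
    at-end (inj₁ q≡N) = q≡N
    at-end (inj₂ (inj₁ (1+x<A , _))) = ⊥-elim (<⇒≱ (<-trans 1+x<A A<B) B≤1+x)
    at-end (inj₂ (inj₂ (1+x<B , _))) = ⊥-elim (<⇒≱ 1+x<B B≤1+x)

  netWindow⇒netPosition : ∀ {p q} → NetWindow p q → NetPosition p q
  netWindow⇒netPosition {zero} (() , _)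
  netWindow⇒netPosition {suc zero} (_ , _ , _ , rep , _ , right) = inj₂ (inj₁ (refl , net-at-start rep right))
  netWindow⇒netPosition {suc (suc x)} (_ , _ , _ , _ , inj₁ () , _)
  netWindow⇒netPosition {suc (suc x)} (_ , _ , _ , rep , inj₂ left , right) with net-inside rep left right
  ... | inj₁ (1+x≡B , q≡N) = inj₁ (cong suc 1+x≡B , q≡N)
  ... | inj₂ (1+x≡A , q≡A+ℓ) = inj₂ (inj₂ (cong suc 1+x≡A , q≡A+ℓ))

  netPosition⇒netWindow : ∀ {p q} → NetPosition p q → NetWindow p q
  netPosition⇒netWindow (inj₁ (refl , refl)) =
    s≤s z≤n , B<N , ≤-refl , inj₂ (inj₂ ≤-refl) ,
    inj₂ (inj₂ (n∸1<n (<-trans 0<A A<B) , A+ℓ<N)) , inj₁ refl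
  netPosition⇒netWindow (inj₂ (inj₁ (refl , refl))) =
    ≤-refl , 0<ℓ , <⇒≤ (<-trans ℓ<A+ℓ A+ℓ<N) , inj₁ ≤-refl , inj₁ refl , inj₂ (inj₁ (0<A , n<1+n ℓ))
  netPosition⇒netWindow (inj₂ (inj₂ (refl , refl))) =
    s≤s z≤n , m<m+n A 0<ℓ , <⇒≤ A+ℓ<N , inj₂ (inj₁ (≤-refl , ≤-refl)) ,
    inj₂ (inj₁ (n∸1<n 0<A , ℓ<A+ℓ)) , inj₂ (inj₂ (A<B , n<1+n (A + ℓ)))

  netWindow⇔netPosition : ∀ p q → NetWindow p q ⇔ NetPosition p q
  netWindow⇔netPosition _ _ = mk⇔ netWindow⇒netPosition netPosition⇒netWindow

module Layout (m : ℕ) where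

  T P : Word
  T = F (7 + m)
  P = F (5 + m) ++ Q (7 + m)

  A B ℓ N : ℕ
  A = f (5 + m)
  B = f (6 + m)
  ℓ = length P
  N = f (7 + m)

  P≡Qdown : P ≡ Qdown (4 + m)
  P≡Qdown = ++-assoc (F (4 + m)) (F (3 + m)) (Qdown (2 + m))

  F-prefix : Occurrence T (F (5 + m))
  F-prefix = occurrence [] (F (4 + m) ++ F (5 + m)) (++-assoc (F (5 + m)) (F (4 + m)) (F (5 + m)))

  F-suffix : Occurrence T (F (5 + m))
  F-suffix = occurrence (F (6 + m)) [] (cong (F (6 + m) ++_) (sym (++-identityʳ (F (5 + m)))))

  P-prefix : Occurrence T P
  P-prefix = occurrence [] rest (begin
    F (6 + m) ++ F (5 + m)                                     ≡⟨ cong (_++ F (5 + m)) (F-ends (3 + m)) ⟩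
    ((Qdown (4 + m) ++ X (3 + m) ∷ []) ++ flip (X (3 + m)) ∷ []) ++ F (5 + m)
                                                               ≡⟨ ++-∷ʳ-∷ʳ (Qdown (4 + m)) _ _ _ ⟩
    Qdown (4 + m) ++ rest                                      ≡⟨ cong (_++ rest) P≡Qdown ⟨
    P ++ rest                                                  ∎)
    where
    open ≡-Reasoning
    rest = X (3 + m) ∷ flip (X (3 + m)) ∷ F (5 + m)

  P-shifted : Occurrence T P
  P-shifted = occurrence (F (5 + m)) xy (begin
    (F (5 + m) ++ F (4 + m)) ++ F (5 + m)          ≡⟨ ++-assoc (F (5 + m)) (F (4 + m)) (F (5 + m)) ⟩
    F (5 + m) ++ F (4 + m) ++ F (5 + m)            ≡⟨ cong (λ z → F (5 + m) ++ F (4 + m) ++ z) (F-ends (2 + m)) ⟩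
    F (5 + m) ++ F (4 + m) ++ (Qdown (3 + m) ++ X (2 + m) ∷ []) ++ flip (X (2 + m)) ∷ []
        ≡⟨ cong (λ z → F (5 + m) ++ F (4 + m) ++ z) (++-assoc (Qdown (3 + m)) _ _) ⟩
    F (5 + m) ++ F (4 + m) ++ Qdown (3 + m) ++ xy  ≡⟨ cong (F (5 + m) ++_) (++-assoc (F (4 + m)) (Qdown (3 + m)) xy) ⟨
    F (5 + m) ++ Qdown (4 + m) ++ xy               ≡⟨ cong (λ z → F (5 + m) ++ z ++ xy) P≡Qdown ⟨
    F (5 + m) ++ P ++ xy                           ∎)
    where
    open ≡-Reasoning
    xy = X (2 + m) ∷ flip (X (2 + m)) ∷ []

  w₁-occurrence : Occurrence T (w (1 + m))
  w₁-occurrence = occurrence U₁ (X (2 + m) ∷ F (5 + m)) (begin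
    F (6 + m) ++ F (5 + m)                            ≡⟨ cong (_++ F (5 + m)) (F-around-w (1 + m)) ⟩
    (U₁ ++ w (1 + m) ++ X (2 + m) ∷ []) ++ F (5 + m)  ≡⟨ ++-assoc U₁ _ _ ⟩
    U₁ ++ (w (1 + m) ++ X (2 + m) ∷ []) ++ F (5 + m)  ≡⟨ cong (U₁ ++_) (++-assoc (w (1 + m)) _ _) ⟩
    U₁ ++ w (1 + m) ++ X (2 + m) ∷ F (5 + m)          ∎)
    where
    open ≡-Reasoning
    U₁ = Qdown (3 + m) ++ X (2 + m) ∷ []

  w₂-occurrence : Occurrence T (w (2 + m))
  w₂-occurrence = occurrence (Qdown (4 + m) ++ X (3 + m) ∷ []) (X (3 + m) ∷ []) (F-around-w (2 + m))

  1+start-w₁≡A : suc (start w₁-occurrence) ≡ A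
  1+start-w₁≡A = sym (f-ends (2 + m))

  1+start-w₂≡B : suc (start w₂-occurrence) ≡ B
  1+start-w₂≡B = sym (f-ends (3 + m))

  start-w₂≡1+ℓ : start w₂-occurrence ≡ suc ℓ
  start-w₂≡1+ℓ = trans (length-∷ʳ (Qdown (4 + m)) _) (cong (suc ∘ length) (sym P≡Qdown))

  end-w₁≡1+ℓ : end w₁-occurrence ≡ suc ℓ
  end-w₁≡1+ℓ =
    suc-injective (trans (sym (f-around-w (1 + m))) (trans (sym 1+start-w₂≡B) (cong suc start-w₂≡1+ℓ)))

  N≡B+A : N ≡ B + A
  N≡B+A = length-++ (F (6 + m))

  N≡2+A+ℓ : N ≡ 2 + (A + ℓ)
  N≡2+A+ℓ = begin
    N                                        ≡⟨ cong length (split P-shifted) ⟩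
    length (F (5 + m) ++ P ++ after P-shifted)  ≡⟨ length-++ (F (5 + m)) ⟩
    A + length (P ++ after P-shifted)        ≡⟨ cong (A +_) (trans (length-++ P) (+-comm ℓ 2)) ⟩
    A + (2 + ℓ)                              ≡⟨ trans (+-suc A (suc ℓ)) (cong suc (+-suc A ℓ)) ⟩
    2 + (A + ℓ)                              ∎
    where open ≡-Reasoning

  end-w₂≡1+A+ℓ : end w₂-occurrence ≡ suc (A + ℓ)
  end-w₂≡1+A+ℓ = suc-injective (trans (sym (f-around-w (2 + m))) N≡2+A+ℓ)

  0<A : 0 < A
  0<A = subst (0 <_) 1+start-w₁≡A (s≤s z≤n)

  A≤ℓ : A ≤ ℓ
  A≤ℓ = subst (A ≤_) (sym (length-++ (F (5 + m)))) (m≤m+n A _)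

  A<B : A < B
  A<B = subst (A <_) (trans (cong suc (sym start-w₂≡1+ℓ)) 1+start-w₂≡B) (s≤s (m≤n⇒m≤1+n A≤ℓ))

  B<N : B < N
  B<N = subst (B <_) (sym N≡B+A) (m<m+n B 0<A)

  A+ℓ<N : A + ℓ < N
  A+ℓ<N = subst (A + ℓ <_) (sym N≡2+A+ℓ) (m≤n⇒m≤1+n (n<1+n (A + ℓ)))

  0<ℓ : 0 < ℓ
  0<ℓ = ≤-trans 0<A A≤ℓ

  open Windows A B ℓ N 0<A 0<ℓ A<B B<N A+ℓ<N public

  unique-window : ∀ {M} (o : Occurrence T M) → 0 < length M → UniqueWindow (start o) (end o) → Unique T M
  unique-window o 0<M (inj₁ (x<A , ℓ<y)) =
    unique o 0<M (at-most-once-cover o w₁-occurrence (s≤s⁻¹ (≤-trans x<A (≤-reflexive (sym 1+start-w₁≡A))))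
      (≤-trans (≤-reflexive end-w₁≡1+ℓ) ℓ<y) (w-at-most-once-F6 (1 + m)))
  unique-window o 0<M (inj₂ (x<B , A+ℓ<y)) =
    unique o 0<M (at-most-once-cover o w₂-occurrence (s≤s⁻¹ (≤-trans x<B (≤-reflexive (sym 1+start-w₂≡B))))
      (≤-trans (≤-reflexive end-w₂≡1+A+ℓ) A+ℓ<y) (w-at-most-once-F5 (2 + m)))

  repeated-window : ∀ {M} (o : Occurrence T M) → end o ≤ N → RepeatedWindow (start o) (end o) → Repeated T M
  repeated-window o _ (inj₁ y≤ℓ) =
    repeated-inside o P-prefix P-shifted (<⇒≢ 0<A) z≤n y≤ℓ
  repeated-window o _ (inj₂ (inj₁ (A≤x , y≤A+ℓ))) =
    repeated-inside o P-shifted P-prefix (<⇒≢ 0<A ∘ sym) A≤x y≤A+ℓ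
  repeated-window o y≤N (inj₂ (inj₂ B≤x)) =
    repeated-inside o F-suffix F-prefix (<⇒≢ (<-trans 0<A A<B) ∘ sym) B≤x (≤-trans y≤N (≤-reflexive N≡B+A))

  window⇔ : ∀ {x y} → x < y → y ≤ N →
    (Unique T (sub T (suc x) y) ⇔ UniqueWindow x y) × (Repeated T (sub T (suc x) y) ⇔ RepeatedWindow x y)
  window⇔ {x} {y} x<y y≤N with sub-occurrence T x<y y≤N
  ... | o , start≡x , end≡y , 0<M =
    mk⇔ (λ u → [ id , ⊥-elim ∘ unique⇒¬repeated u ∘ repeated′ ]′ (classify x y)) unique′ ,
    mk⇔ (λ r → [ (λ uw → ⊥-elim (unique⇒¬repeated (unique′ uw) r)) , id ]′ (classify x y)) repeated′
    where
    unique′ : UniqueWindow x y → Unique T (sub T (suc x) y)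
    unique′ = unique-window o 0<M ∘ subst₂ UniqueWindow (sym start≡x) (sym end≡y)
    repeated′ : RepeatedWindow x y → Repeated T (sub T (suc x) y)
    repeated′ = repeated-window o (subst (_≤ N) (sym end≡y) y≤N)
              ∘ subst₂ RepeatedWindow (sym start≡x) (sym end≡y)

  repeated⇔ : ∀ {p q} → 1 ≤ p → p ≤ q → q ≤ N → Repeated T (sub T p q) ⇔ RepeatedWindow (p ∸ 1) q
  repeated⇔ {suc x} _ p≤q q≤N = proj₂ (window⇔ p≤q q≤N)

  left⇔ : ∀ {p q} → 1 ≤ p → p ≤ q → q ≤ N →
    (p ≡ 1 ⊎ Unique T (sub T (p ∸ 1) q)) ⇔ (p ≡ 1 ⊎ UniqueWindow (p ∸ 2) q)
  left⇔ {suc zero} _ _ _ = mk⇔ (λ _ → inj₁ refl) (λ _ → inj₁ refl)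
  left⇔ {suc (suc x)} _ p≤q q≤N = ⇔-id _ ⊎-⇔ proj₁ (window⇔ (<⇒≤ p≤q) q≤N)

  right⇔ : ∀ {p q} → 1 ≤ p → p ≤ q → q ≤ N →
    (q ≡ N ⊎ Unique T (sub T p (suc q))) ⇔ (q ≡ N ⊎ UniqueWindow (p ∸ 1) (suc q))
  right⇔ {suc x} _ p≤q q≤N with m≤n⇒m<n∨m≡n q≤N
  ... | inj₁ q<N = ⇔-id _ ⊎-⇔ proj₁ (window⇔ (m≤n⇒m≤1+n p≤q) q<N)
  ... | inj₂ q≡N = mk⇔ (λ _ → inj₁ q≡N) (λ _ → inj₁ q≡N)

  netOcc⇔netWindow : ∀ p q → NetOcc T p q ⇔ NetWindow p q
  netOcc⇔netWindow p q = mk⇔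
    (λ (1≤p , p≤q , q≤N , rep , left , right) → 1≤p , p≤q , q≤N ,
      to (repeated⇔ 1≤p p≤q q≤N) rep , to (left⇔ 1≤p p≤q q≤N) left ,
      to (right⇔ 1≤p p≤q q≤N) right)
    (λ (1≤p , p≤q , q≤N , rep , left , right) → 1≤p , p≤q , q≤N ,
      from (repeated⇔ 1≤p p≤q q≤N) rep , from (left⇔ 1≤p p≤q q≤N) left ,
      from (right⇔ 1≤p p≤q q≤N) right)
    where open Equivalence

theorem33 : (i : ℕ) → 7 ≤ i → (p q : ℕ) →
    NetOcc (F i) p q ⇔
      (((p ≡ f (i ∸ 1) + 1) × (q ≡ p + f (i ∸ 2) ∸ 1) × (sub (F i) p q ≡ F (i ∸ 2)))
      ⊎ ((p ≡ 1) × (q ≡ p + length (F (i ∸ 2) ++ Q i) ∸ 1) × (sub (F i) p q ≡ F (i ∸ 2) ++ Q i))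
      ⊎ ((p ≡ f (i ∸ 2) + 1) × (q ≡ p + length (F (i ∸ 2) ++ Q i) ∸ 1) × (sub (F i) p q ≡ F (i ∸ 2) ++ Q i)))
theorem33 i 7≤i p q with m≤n⇒∃[o]m+o≡n 7≤i
... | m , refl =
  ⇔-sym (occurrence⇔ F-suffix 0<A (sym N≡B+A)
         ⊎-⇔ occurrence⇔ P-prefix 0<ℓ refl
         ⊎-⇔ occurrence⇔ P-shifted 0<ℓ refl)
  ⇔-∘ (netWindow⇔netPosition p q ⇔-∘ netOcc⇔netWindow p q)
  where open Layout m
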